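{- If $T$ is a tree of order $n$, then $\eta(T)\le 2a(T)-n$.
   Context: The nullity $\eta(T)$ is the multiplicity of the eigenvalue $0$ of the adjacency matrix of $T$. For a graph $G$ with $m$ edges and vertex degrees sorted as $d_1\le d_2\le\dots\le d_n$, the annihilation number $a(G)$ is the largest index $a$ such that $\sum_{i=1}^{a} d_i\le m$. -}

module Defs where

open import Data.Nat using (ℕ; zero; suc; _+_; _*_; _≤_; _<_)
open import Data.Nat.Properties using (≤-decTotalOrder)
open import Data.Bool using (Bool; true; false; if_then_else_)
open import Data.Fin using (Fin; zero; suc; toℕ; inject₁; fromℕ)
open import Data.List using (List; []; _∷_; take; map; length)
open import Data.Nat.ListAction using (sum)
open import Data.List.Sort ≤-decTotalOrder using (sort)
open import Data.Product using (Σ; _×_; _,_; ∃)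
open import Relation.Binary.PropositionalEquality using (_≡_; _≢_)
open import Relation.Nullary using (¬_)
open import Function.Definitions using (Injective)
import Data.Rational as ℚ
open ℚ using (ℚ; 0ℚ; 1ℚ)

record Graph (n : ℕ) : Set where
  field
    adj     : Fin n → Fin n → Bool
    sym     : ∀ u v → adj u v ≡ adj v u
    irrefl  : ∀ v → adj v v ≡ false
open Graph public

Adj : ∀ {n} → Graph n → Fin n → Fin n → Set
Adj G u v = adj G u v ≡ true

vertices : ∀ n → List (Fin n)
vertices zero    = []
vertices (suc n) = zero ∷ map suc (vertices n)

count : ∀ {A : Set} → (A → Bool) → List A → ℕ
count p []       = 0
count p (x ∷ xs) = (if p x then 1 else 0) + count p xs

degree : ∀ {n} → Graph n → Fin n → ℕ
degree {n} G v = count (adj G v) (vertices n)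

edgesFrom : ∀ {n} → Graph n → Fin n → ℕ
edgesFrom {n} G u =
  count (λ v → if Data.Nat._<ᵇ_ (toℕ u) (toℕ v) then adj G u v else false) (vertices n)

size : ∀ {n} → Graph n → ℕ
size {n} G = sum (map (edgesFrom G) (vertices n))

data Walk {n} (G : Graph n) : Fin n → Fin n → Set where
  here : ∀ {v} → Walk G v v
  step : ∀ {u w v} → Adj G u w → Walk G w v → Walk G u v

Connected : ∀ {n} → Graph n → Set
Connected {n} G = ∀ (u v : Fin n) → Walk G u v

Cycle : ∀ {n} → Graph n → Set
Cycle {n} G =
  Σ ℕ λ k → Σ (Fin (suc (suc (suc k))) → Fin n) λ c →
    Injective _≡_ _≡_ c
    × (∀ (i : Fin (suc (suc k))) → Adj G (c (inject₁ i)) (c (suc i)))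
    × Adj G (c (fromℕ (suc (suc k)))) (c zero)

Acyclic : ∀ {n} → Graph n → Set
Acyclic G = ¬ Cycle G

IsTree : ∀ {n} → Graph n → Set
IsTree {n} G = (1 ≤ n) × Connected G × Acyclic G

sortedDegrees : ∀ {n} → Graph n → List ℕ
sortedDegrees {n} G = sort (map (degree G) (vertices n))

IsAnnihilationNumber : ∀ {n} → Graph n → ℕ → Set
IsAnnihilationNumber {n} G a =
  a ≤ n
  × sum (take a (sortedDegrees G)) ≤ size G
  × (∀ b → b ≤ n → sum (take b (sortedDegrees G)) ≤ size G → b ≤ a)

Σ[_] : ∀ {n} → (Fin n → ℚ) → ℚ
Σ[_] {zero}  f = 0ℚ
Σ[_] {suc n} f = f zero ℚ.+ Σ[ (λ i → f (suc i)) ]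

A[_] : ∀ {n} → Graph n → Fin n → Fin n → ℚ
A[ G ] u v = if adj G u v then 1ℚ else 0ℚ

InKernel : ∀ {n} → Graph n → (Fin n → ℚ) → Set
InKernel G x = ∀ u → Σ[ (λ v → A[ G ] u v ℚ.* x v) ] ≡ 0ℚ

LinearlyIndependent : ∀ {n k} → (Fin k → Fin n → ℚ) → Set
LinearlyIndependent {n} {k} xs =
  ∀ (c : Fin k → ℚ) → (∀ u → Σ[ (λ l → c l ℚ.* xs l u) ] ≡ 0ℚ) → ∀ l → c l ≡ 0ℚ

-- η is the nullity of G: the dimension of the null space of A(G),
-- i.e. the maximum size of a linearly independent family in ker A(G).
-- (A(G) is real symmetric, so this equals the multiplicity of eigenvalue 0.)
IsNullity : ∀ {n} → Graph n → ℕ → Set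
IsNullity {n} G η =
  (Σ (Fin η → Fin n → ℚ) λ xs → (∀ l → InKernel G (xs l)) × LinearlyIndependent xs)
  × (∀ k (xs : Fin k → Fin n → ℚ) → (∀ l → InKernel G (xs l)) → LinearlyIndependent xs → k ≤ η)

{-# OPTIONS --safe #-}
module Submission where

-- Peel pendant edges off the tree one at a time.  If v is a leaf of what
-- is left and u its neighbour, the equations of A x = 0 at v and at u force
-- every null vector to vanish at u and at v, and v can join an independent
-- set.  Once no edge is left, the remaining vertices W are isolated and join
-- the independent set too.  This yields an independent set I with
-- 2|I| = |W| + n such that null vectors are determined by their values on W,
-- so η ≤ |W|.  Finally the degrees of an independent set sum to at most m,
-- hence so do the |I| smallest degrees, i.e. |I| ≤ a.

open import Algebra.Bundles using (CommutativeRing)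
import Algebra.Properties.Semiring.Sum as SemiringSum
open import Data.Bool using (Bool; true; false; if_then_else_; _∧_; not)
import Data.Bool.Properties as Bool
open import Data.Fin using (Fin; zero; suc; punchIn; inject₁; fromℕ; toℕ)
open import Data.Fin.Properties using (any?; punchInᵢ≢i; pigeonhole; _≟_; <-irrefl; toℕ-injective)
open import Data.List using (List; []; _∷_; _++_; [_]; length; lookup; map; filterᵇ; take)
open import Data.List.Properties using (++-assoc; map-∘; map-++; length-map)
open import Data.List.Membership.Propositional using (_∈_)
open import Data.List.Membership.Propositional.Properties using (∈-lookup; ∈-∃++; ∈-map⁺; ∈-filter⁺; ∈-++⁻)
open import Data.List.Relation.Binary.Permutation.Propositional using (_↭_; ↭-refl; ↭-sym; ↭-trans; prep)
open import Data.List.Relation.Binary.Permutation.Propositional.Properties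
  using (shift; drop-∷; ∈-resp-↭; ↭-length; ++⁺ˡ; ++⁺ʳ; map⁺)
open import Data.List.Relation.Unary.All as All using (All; []; _∷_)
open import Data.List.Relation.Unary.All.Properties using (++⁻ˡ; ++⁻ʳ; ¬Any⇒All¬)
open import Data.List.Relation.Unary.Any as Any using (here; there)
open import Data.List.Relation.Unary.Any.Properties using (lookup-index)
open import Data.List.Relation.Unary.Linked as Linked using (Linked; []; [-]; _∷_)
open import Data.List.Relation.Unary.Unique.Propositional using (Unique; []; _∷_)
open import Data.Nat using (ℕ; zero; suc; _+_; _*_; _≤_; _<_; _<ᵇ_; z≤n; s≤s; z<s)
open import Data.Nat.ListAction using (sum)
open import Data.Nat.ListAction.Properties using (sum-↭)
import Data.Nat.Properties as ℕₚ
open import Data.Nat.Solver using (module +-*-Solver)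
open import Data.List.Sort ℕₚ.≤-decTotalOrder using (sort-↭; sort-↗)
open import Data.Product using (∃; _×_; _,_; proj₁; proj₂)
import Data.Rational as ℚ
open ℚ using (ℚ; 0ℚ; 1ℚ; 1/_; ≢-nonZero)
import Data.Rational.Properties as ℚₚ
import Data.Rational.Solver as ℚ-Solver
open import Data.Sum using (_⊎_; inj₁; inj₂; [_,_]′)
open import Data.Vec.Functional using (insertAt; updateAt)
open import Data.Vec.Functional.Properties
  using (insertAt-lookup; insertAt-punchIn; updateAt-updates; updateAt-minimal)
open import Function using (_∘_; const)
open import Function.Bundles using (Equivalence)
open import Relation.Binary.Definitions using (tri<; tri≈; tri>)
open import Relation.Binary.PropositionalEquality
  using (_≡_; _≢_; refl; sym; trans; cong; cong₂; subst; subst₂; ≢-sym; module ≡-Reasoning)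
open import Relation.Nullary using (Dec; yes; no; ¬?)
open import Relation.Nullary.Decidable using (decidable-stable; _×-dec_)
open import Relation.Nullary.Negation using (contradiction)

open import Defs renaming (sym to adj-sym)

module ℚΣ = SemiringSum (CommutativeRing.semiring ℚₚ.+-*-commutativeRing)
module ℕΣ = SemiringSum ℕₚ.+-*-semiring

-- Linear algebra over ℚ

Σ[]≡sum : ∀ {n} (f : Fin n → ℚ) → Σ[ f ] ≡ ℚΣ.sum f
Σ[]≡sum {zero}  f = refl
Σ[]≡sum {suc n} f = cong (f zero ℚ.+_) (Σ[]≡sum (f ∘ suc))

lincomb : ∀ {k d} → (Fin k → ℚ) → (Fin k → Fin d → ℚ) → Fin d → ℚ
lincomb c xs u = ℚΣ.sum (λ l → c l ℚ.* xs l u)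

lincomb-vanishing : ∀ {k d} c (xs : Fin k → Fin d → ℚ) u →
                    (∀ l → xs l u ≡ 0ℚ) → lincomb c xs u ≡ 0ℚ
lincomb-vanishing {k} c xs u vanishing = begin
  ℚΣ.sum (λ l → c l ℚ.* xs l u) ≡⟨ ℚΣ.sum-cong-≗ term ⟩
  ℚΣ.sum {k} (λ _ → 0ℚ)         ≡⟨ ℚΣ.sum-replicate-zero k ⟩
  0ℚ                            ∎
  where
  open ≡-Reasoning
  term : ∀ l → c l ℚ.* xs l u ≡ 0ℚ
  term l = trans (cong (c l ℚ.*_) (vanishing l)) (ℚₚ.*-zeroʳ (c l))

Independent : ∀ {k d} → (Fin k → Fin d → ℚ) → Set
Independent xs = ∀ c → (∀ u → lincomb c xs u ≡ 0ℚ) → ∀ l → c l ≡ 0ℚ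

LinearlyIndependent⇒Independent : ∀ {k d} {xs : Fin k → Fin d → ℚ} →
                                  LinearlyIndependent xs → Independent xs
LinearlyIndependent⇒Independent {xs = xs} independent c vanishes =
  independent c (λ u → trans (Σ[]≡sum (λ l → c l ℚ.* xs l u)) (vanishes u))

module Elimination {k d} (xs : Fin (suc k) → Fin d → ℚ) (p : Fin (suc k))
                   (p₀ : Fin d) (q : ℚ) (q*pivot≡1 : q ℚ.* xs p p₀ ≡ 1ℚ) where

  open ℚ-Solver.+-*-Solver

  factor : Fin k → ℚ
  factor i = xs (punchIn p i) p₀ ℚ.* q

  reduced : Fin k → Fin d → ℚ
  reduced i u = xs (punchIn p i) u ℚ.- factor i ℚ.* xs p u

  reduced-pivot : ∀ i → reduced i p₀ ≡ 0ℚ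
  reduced-pivot i = begin
    x ℚ.- x ℚ.* q ℚ.* xs p p₀   ≡⟨ cong (λ t → x ℚ.- t) (ℚₚ.*-assoc x q (xs p p₀)) ⟩
    x ℚ.- x ℚ.* (q ℚ.* xs p p₀) ≡⟨ cong (λ t → x ℚ.- x ℚ.* t) q*pivot≡1 ⟩
    x ℚ.- x ℚ.* 1ℚ              ≡⟨ cong (λ t → x ℚ.- t) (ℚₚ.*-identityʳ x) ⟩
    x ℚ.- x                     ≡⟨ ℚₚ.+-inverseʳ x ⟩
    0ℚ                          ∎
    where
    open ≡-Reasoning
    x = xs (punchIn p i) p₀

  lift : (Fin k → ℚ) → Fin (suc k) → ℚ
  lift c = insertAt c p (ℚ.- ℚΣ.sum (λ i → c i ℚ.* factor i))

  lincomb-lift : ∀ c u → lincomb (lift c) xs u ≡ lincomb c reduced u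
  lincomb-lift c u = begin
    lincomb (lift c) xs u
      ≡⟨ ℚΣ.sum-remove {i = p} (λ l → lift c l ℚ.* xs l u) ⟩
    lift c p ℚ.* y ℚ.+ ℚΣ.sum (λ i → lift c (punchIn p i) ℚ.* x i)
      ≡⟨ cong₂ (λ a t → a ℚ.* y ℚ.+ t) (insertAt-lookup c p _)
               (ℚΣ.sum-cong-≗ (λ i → cong (ℚ._* x i) (insertAt-punchIn c p _ i))) ⟩
    ℚ.- S ℚ.* y ℚ.+ T
      ≡⟨ solve 3 (λ s y t → :- s :* y :+ t := t :+ s :* (:- y)) refl S y T ⟩
    T ℚ.+ S ℚ.* ℚ.- y
      ≡⟨ cong (T ℚ.+_) (ℚΣ.*-distribʳ-sum (ℚ.- y) (λ i → c i ℚ.* factor i)) ⟩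
    T ℚ.+ ℚΣ.sum (λ i → c i ℚ.* factor i ℚ.* ℚ.- y)
      ≡⟨ ℚΣ.∑-distrib-+ (λ i → c i ℚ.* x i) (λ i → c i ℚ.* factor i ℚ.* ℚ.- y) ⟨
    ℚΣ.sum (λ i → c i ℚ.* x i ℚ.+ c i ℚ.* factor i ℚ.* ℚ.- y)
      ≡⟨ ℚΣ.sum-cong-≗ (λ i → solve 4 (λ a x r y → a :* x :+ a :* r :* (:- y) := a :* (x :- r :* y))
                                  refl (c i) (x i) (factor i) y) ⟩
    lincomb c reduced u ∎
    where
    open ≡-Reasoning
    x : Fin k → ℚ
    x i = xs (punchIn p i) u
    y = xs p u
    S = ℚΣ.sum (λ i → c i ℚ.* factor i)
    T = ℚΣ.sum (λ i → c i ℚ.* x i)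

  reduced-independent : Independent xs → Independent reduced
  reduced-independent independent c vanishes i = begin
    c i                  ≡⟨ insertAt-punchIn c p _ i ⟨
    lift c (punchIn p i) ≡⟨ independent (lift c) (λ u → trans (lincomb-lift c u) (vanishes u)) _ ⟩
    0ℚ                   ∎
    where open ≡-Reasoning

drop-vanishing-coordinate : ∀ {k d} (xs : Fin k → Fin (suc d) → ℚ) → (∀ l → xs l zero ≡ 0ℚ) →
                            Independent xs → Independent (λ l → xs l ∘ suc)
drop-vanishing-coordinate xs vanishing independent c vanishes = independent c all-coordinates
  where
  all-coordinates : ∀ u → lincomb c xs u ≡ 0ℚ
  all-coordinates zero    = lincomb-vanishing c xs zero vanishing
  all-coordinates (suc u) = vanishes u

independent⇒≤dim : ∀ {k} d (xs : Fin k → Fin d → ℚ) → Independent xs → k ≤ d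
independent⇒≤dim {zero}  _       _  _           = z≤n
independent⇒≤dim {suc k} zero    xs independent =
  contradiction (independent (λ _ → 1ℚ) (λ ()) zero) ℚₚ.1≢0
independent⇒≤dim {suc k} (suc d) xs independent with any? (λ l → ¬? (xs l zero ℚₚ.≟ 0ℚ))
... | yes (p , pivot≢0) =
  s≤s (independent⇒≤dim d (λ i → reduced i ∘ suc)
         (drop-vanishing-coordinate reduced reduced-pivot (reduced-independent independent)))
  where
  instance _ = ≢-nonZero pivot≢0
  open Elimination xs p zero (1/ xs p zero) (ℚₚ.*-inverseˡ (xs p zero))
... | no  no-pivot =
  ℕₚ.m≤n⇒m≤1+n (independent⇒≤dim d (λ l → xs l ∘ suc)
                 (drop-vanishing-coordinate xs vanishing independent))
  where
  vanishing : ∀ l → xs l zero ≡ 0ℚ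
  vanishing l = decidable-stable (xs l zero ℚₚ.≟ 0ℚ) (λ ≢0 → no-pivot (l , ≢0))

-- Paths and pendant edges

module _ {A : Set} where

  lookup-injective : ∀ {xs : List A} → Unique xs → ∀ i j → lookup xs i ≡ lookup xs j → i ≡ j
  lookup-injective (_    ∷ _)        zero    zero    _  = refl
  lookup-injective (x∉xs ∷ _)        zero    (suc j) x≡ = contradiction x≡ (All.lookup x∉xs (∈-lookup j))
  lookup-injective (x∉xs ∷ _)        (suc i) zero    ≡x = contradiction (sym ≡x) (All.lookup x∉xs (∈-lookup i))
  lookup-injective (_    ∷ distinct) (suc i) (suc j) eq = cong suc (lookup-injective distinct i j eq)

  Unique-++-∷⁻ : ∀ (xs : List A) {y ys} → Unique (xs ++ y ∷ ys) → Unique (y ∷ xs)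
  Unique-++-∷⁻ []       _                = [] ∷ []
  Unique-++-∷⁻ (x ∷ xs) (x∉ ∷ distinct) with Unique-++-∷⁻ xs distinct
  ... | y∉xs ∷ xs-distinct =
    (≢-sym (All.head (++⁻ʳ xs x∉)) ∷ y∉xs) ∷ (++⁻ˡ xs x∉ ∷ xs-distinct)

  module _ {R : A → A → Set} where

    Linked-++⁻ˡ : ∀ xs {ys} → Linked R (xs ++ ys) → Linked R xs
    Linked-++⁻ˡ []           _       = []
    Linked-++⁻ˡ (_ ∷ [])     _       = [-]
    Linked-++⁻ˡ (_ ∷ x ∷ xs) (r ∷ l) = r ∷ Linked-++⁻ˡ (x ∷ xs) l

    Linked-lookup : ∀ {x xs} → Linked R (x ∷ xs) → ∀ i → R (lookup (x ∷ xs) (inject₁ i)) (lookup xs i)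
    Linked-lookup (r ∷ _) zero    = r
    Linked-lookup (_ ∷ l) (suc i) = Linked-lookup l i

    Linked-last : ∀ x xs {y} → Linked R (x ∷ xs ++ [ y ]) → R (lookup (x ∷ xs) (fromℕ (length xs))) y
    Linked-last _ []       (r ∷ _) = r
    Linked-last _ (x ∷ xs) (_ ∷ l) = Linked-last x xs l

Unique⇒length≤ : ∀ {n} {xs : List (Fin n)} → Unique xs → length xs ≤ n
Unique⇒length≤ {xs = xs} distinct = ℕₚ.≮⇒≥ λ n<length →
  let i , j , i<j , same = pigeonhole n<length (lookup xs)
  in <-irrefl (lookup-injective distinct i j same) i<j

Adj⇒≢ : ∀ {n} (G : Graph n) {u v} → Adj G u v → u ≢ v
Adj⇒≢ G {u} u~v refl = contradiction (trans (sym u~v) (irrefl G u)) λ ()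

Adj-sym : ∀ {n} (G : Graph n) {u v} → Adj G u v → Adj G v u
Adj-sym G {u} {v} u~v = trans (adj-sym G v u) u~v

closed-walk⇒Cycle : ∀ {n} (G : Graph n) {x y z} zs →
                    Linked (Adj G) (x ∷ y ∷ z ∷ zs ++ [ x ]) → Unique (x ∷ y ∷ z ∷ zs) → Cycle G
closed-walk⇒Cycle G {x} {y} {z} zs walk distinct =
  length zs , lookup vs , (λ {i} {j} → lookup-injective distinct i j) ,
  Linked-lookup (Linked-++⁻ˡ vs walk) , Linked-last x (y ∷ z ∷ zs) walk
  where vs = x ∷ y ∷ z ∷ zs

record PendantEdge {n} (G : Graph n) (R : Fin n → Bool) : Set where
  field
    leaf stem      : Fin n
    leaf∈R         : R leaf ≡ true
    stem∈R         : R stem ≡ true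
    leaf~stem      : Adj G leaf stem
    only-neighbour : ∀ w → R w ≡ true → Adj G leaf w → w ≡ stem

module _ {n} (G : Graph n) (acyclic : Acyclic G) (R : Fin n → Bool) where

  private
    InR : Fin n → Set
    InR v = R v ≡ true

  other-neighbour? : ∀ h s → Dec (∃ λ w → InR w × Adj G h w × w ≢ s)
  other-neighbour? h s = any? λ w → (R w Bool.≟ true) ×-dec (adj G h w Bool.≟ true) ×-dec ¬? (w ≟ s)

  -- The path h ∷ s ∷ rest in R is extended at h until h has no other
  -- neighbour in R.  It has at most n vertices, so the fuel never runs out,
  -- and acyclicity keeps it from running into itself.
  grow-path : ∀ fuel h s rest → n < length (h ∷ s ∷ rest) + fuel →
              All InR (h ∷ s ∷ rest) → Linked (Adj G) (h ∷ s ∷ rest) → Unique (h ∷ s ∷ rest) →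
              PendantEdge G R
  grow-path zero h s rest too-long _ _ distinct =
    contradiction (Unique⇒length≤ distinct) (ℕₚ.<⇒≱ (subst (n <_) (ℕₚ.+-identityʳ _) too-long))
  grow-path (suc fuel) h s rest long (h∈R ∷ s∈R ∷ rest⊆R) walk@(h~s ∷ _) distinct
    with other-neighbour? h s
  ... | no none = record
    { leaf = h ; stem = s ; leaf∈R = h∈R ; stem∈R = s∈R ; leaf~stem = h~s
    ; only-neighbour = λ w w∈R h~w → decidable-stable (w ≟ s) (λ w≢s → none (w , w∈R , h~w , w≢s))
    }
  ... | yes (w , w∈R , h~w , w≢s) with Any.any? (w ≟_) (h ∷ s ∷ rest)
  ...   | no w∉path =
    grow-path fuel w h (s ∷ rest) (subst (n <_) (ℕₚ.+-suc _ fuel) long)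
      (w∈R ∷ h∈R ∷ s∈R ∷ rest⊆R) (Adj-sym G h~w ∷ walk) (¬Any⇒All¬ _ w∉path ∷ distinct)
  ...   | yes (here w≡h)             = contradiction (sym w≡h) (Adj⇒≢ G h~w)
  ...   | yes (there (here w≡s))     = contradiction w≡s w≢s
  ...   | yes (there (there w∈rest)) with ∈-∃++ w∈rest
  ...     | as , bs , refl = contradiction cycle acyclic
    where
    cycle : Cycle G
    cycle = closed-walk⇒Cycle G as
      (Adj-sym G h~w ∷ Linked-++⁻ˡ (h ∷ s ∷ as ++ [ w ])
                         (subst (Linked (Adj G)) (sym (++-assoc (h ∷ s ∷ as) [ w ] bs)) walk))
      (Unique-++-∷⁻ (h ∷ s ∷ as) distinct)

  pendant-edge : ∀ {a b} → R a ≡ true → R b ≡ true → Adj G a b → PendantEdge G R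
  pendant-edge a∈R b∈R a~b =
    grow-path n _ _ [] (ℕₚ.m<n+m n z<s)
      (a∈R ∷ b∈R ∷ []) (a~b ∷ [-]) ((Adj⇒≢ G a~b ∷ []) ∷ [] ∷ [])

⟦_⟧ : Bool → ℕ
⟦ b ⟧ = if b then 1 else 0

∣_∣ : ∀ {n} → (Fin n → Bool) → ℕ
∣ R ∣ = ℕΣ.sum (λ v → ⟦ R v ⟧)

_⊆_ : ∀ {n} → (Fin n → Bool) → (Fin n → Bool) → Set
S ⊆ R = ∀ v → S v ≡ true → R v ≡ true

infixl 6 _[_]≔_
_[_]≔_ : ∀ {A : Set} {n} → (Fin n → A) → Fin n → A → Fin n → A
xs [ i ]≔ y = updateAt xs i (const y)

∣∣≤n : ∀ {n} (R : Fin n → Bool) → ∣ R ∣ ≤ n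
∣∣≤n {zero}  R = z≤n
∣∣≤n {suc n} R with R zero
... | true  = s≤s (∣∣≤n (R ∘ suc))
... | false = ℕₚ.m≤n⇒m≤1+n (∣∣≤n (R ∘ suc))

∣full∣≡n : ∀ n → ∣ const {B = Fin n} true ∣ ≡ n
∣full∣≡n zero    = refl
∣full∣≡n (suc n) = cong suc (∣full∣≡n n)

∣[]≔∣ : ∀ {n} (R : Fin n → Bool) u b → ∣ R [ u ]≔ b ∣ + ⟦ R u ⟧ ≡ ∣ R ∣ + ⟦ b ⟧
∣[]≔∣ {suc n} R zero    b =
  solve 3 (λ b r c → b :+ r :+ c := c :+ r :+ b) refl ⟦ b ⟧ ∣ R ∘ suc ∣ ⟦ R zero ⟧
  where open +-*-Solver using (solve; _:+_; _:=_)
∣[]≔∣ {suc n} R (suc u) b = begin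
  ⟦ R zero ⟧ + ∣ (R ∘ suc) [ u ]≔ b ∣ + ⟦ R (suc u) ⟧   ≡⟨ ℕₚ.+-assoc ⟦ R zero ⟧ _ _ ⟩
  ⟦ R zero ⟧ + (∣ (R ∘ suc) [ u ]≔ b ∣ + ⟦ R (suc u) ⟧) ≡⟨ cong (⟦ R zero ⟧ +_) (∣[]≔∣ (R ∘ suc) u b) ⟩
  ⟦ R zero ⟧ + (∣ R ∘ suc ∣ + ⟦ b ⟧)                     ≡⟨ ℕₚ.+-assoc ⟦ R zero ⟧ _ _ ⟨
  ∣ R ∣ + ⟦ b ⟧                                          ∎
  where open ≡-Reasoning

∣[]≔false∣ : ∀ {n} (R : Fin n → Bool) {u} → R u ≡ true → ∣ R ∣ ≡ suc ∣ R [ u ]≔ false ∣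
∣[]≔false∣ R {u} u∈R = begin
  ∣ R ∣                        ≡⟨ ℕₚ.+-identityʳ ∣ R ∣ ⟨
  ∣ R ∣ + 0                    ≡⟨ ∣[]≔∣ R u false ⟨
  ∣ R [ u ]≔ false ∣ + ⟦ R u ⟧ ≡⟨ cong (λ b → ∣ R [ u ]≔ false ∣ + ⟦ b ⟧) u∈R ⟩
  ∣ R [ u ]≔ false ∣ + 1       ≡⟨ ℕₚ.+-comm _ 1 ⟩
  suc ∣ R [ u ]≔ false ∣       ∎
  where open ≡-Reasoning

∣[]≔true∣ : ∀ {n} (R : Fin n → Bool) {u} → R u ≡ false → ∣ R [ u ]≔ true ∣ ≡ suc ∣ R ∣
∣[]≔true∣ R {u} u∉R = begin
  ∣ R [ u ]≔ true ∣            ≡⟨ ℕₚ.+-identityʳ _ ⟨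
  ∣ R [ u ]≔ true ∣ + 0        ≡⟨ cong (λ b → ∣ R [ u ]≔ true ∣ + ⟦ b ⟧) u∉R ⟨
  ∣ R [ u ]≔ true ∣ + ⟦ R u ⟧  ≡⟨ ∣[]≔∣ R u true ⟩
  ∣ R ∣ + 1                    ≡⟨ ℕₚ.+-comm _ 1 ⟩
  suc ∣ R ∣                    ∎
  where open ≡-Reasoning

-- Leaf peeling

sum-single : ∀ {n} (f : Fin n → ℚ) t → (∀ j → j ≢ t → f j ≡ 0ℚ) → ℚΣ.sum f ≡ f t
sum-single {suc n} f t off-t = begin
  ℚΣ.sum f                               ≡⟨ ℚΣ.sum-remove {i = t} f ⟩
  f t ℚ.+ ℚΣ.sum (λ j → f (punchIn t j)) ≡⟨ cong (f t ℚ.+_) (ℚΣ.sum-cong-≗ (off-t _ ∘ punchInᵢ≢i t)) ⟩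
  f t ℚ.+ ℚΣ.sum {n} (λ _ → 0ℚ)          ≡⟨ cong (f t ℚ.+_) (ℚΣ.sum-replicate-zero n) ⟩
  f t ℚ.+ 0ℚ                             ≡⟨ ℚₚ.+-identityʳ (f t) ⟩
  f t                                    ∎
  where open ≡-Reasoning

A[_]·_ : ∀ {n} → Graph n → (Fin n → ℚ) → Fin n → ℚ
(A[ G ]· x) w = ℚΣ.sum (λ v → A[ G ] w v ℚ.* x v)

module _ {n} (G : Graph n) where

  A-nonadjacent : ∀ {w v} y → adj G w v ≡ false → A[ G ] w v ℚ.* y ≡ 0ℚ
  A-nonadjacent y w≁v rewrite w≁v = ℚₚ.*-zeroˡ y

  A-adjacent : ∀ {w v} y → Adj G w v → A[ G ] w v ℚ.* y ≡ y
  A-adjacent y w~v rewrite w~v = ℚₚ.*-identityˡ y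

  A·-single : ∀ {w t} x → Adj G w t →
              (∀ j → j ≢ t → A[ G ] w j ℚ.* x j ≡ 0ℚ) → (A[ G ]· x) w ≡ x t
  A·-single x w~t off-t = trans (sum-single _ _ off-t) (A-adjacent (x _) w~t)

  A·-[]≔ : ∀ {w v} x y → adj G w v ≡ false → (A[ G ]· (x [ v ]≔ y)) w ≡ (A[ G ]· x) w
  A·-[]≔ {w} {v} x y w≁v = ℚΣ.sum-cong-≗ entry
    where
    entry : ∀ j → A[ G ] w j ℚ.* (x [ v ]≔ y) j ≡ A[ G ] w j ℚ.* x j
    entry j with j ≟ v
    ... | yes refl = trans (A-nonadjacent _ w≁v) (sym (A-nonadjacent _ w≁v))
    ... | no  j≢v  = cong (A[ G ] w j ℚ.*_) (updateAt-minimal j v x j≢v)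

  IndependentSet : (Fin n → Bool) → Set
  IndependentSet I = ∀ a b → I a ≡ true → I b ≡ true → adj G a b ≡ false

  -- null vectors of the subgraph induced by R, extended by zero
  record InducedNull (R : Fin n → Bool) (x : Fin n → ℚ) : Set where
    field
      outside : ∀ v → R v ≡ false → x v ≡ 0ℚ
      rows    : ∀ w → R w ≡ true → (A[ G ]· x) w ≡ 0ℚ

  Determines : (Fin n → Bool) → (Fin n → Bool) → Set
  Determines W R = ∀ x → InducedNull R x → (∀ w → W w ≡ true → x w ≡ 0ℚ) → ∀ v → x v ≡ 0ℚ

  record NullityCertificate (R : Fin n → Bool) : Set where
    field
      W I         : Fin n → Bool
      I⊆R         : I ⊆ R
      independent : IndependentSet I
      counts      : 2 * ∣ I ∣ ≡ ∣ W ∣ + ∣ R ∣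
      determines  : Determines W R

  independent-certificate : ∀ R → IndependentSet R → NullityCertificate R
  independent-certificate R independent = record
    { W = R ; I = R ; I⊆R = λ _ v∈R → v∈R ; independent = independent
    ; counts = cong (∣ R ∣ +_) (ℕₚ.+-identityʳ ∣ R ∣)
    ; determines = determines
    }
    where
    determines : Determines R R
    determines x x-null on-R v with R v in v∈?R
    ... | true  = on-R v v∈?R
    ... | false = InducedNull.outside x-null v v∈?R

  module Peel {R : Fin n → Bool} (e : PendantEdge G R) where

    open PendantEdge e

    R⁻ : Fin n → Bool
    R⁻ = R [ stem ]≔ false [ leaf ]≔ false

    stem≢leaf : stem ≢ leaf
    stem≢leaf = Adj⇒≢ G (Adj-sym G leaf~stem)

    R⁻-agrees : ∀ {w} → w ≢ stem → w ≢ leaf → R⁻ w ≡ R w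
    R⁻-agrees {w} w≢stem w≢leaf = trans (updateAt-minimal w leaf _ w≢leaf) (updateAt-minimal w stem R w≢stem)

    ∣R∣≡2+∣R⁻∣ : ∣ R ∣ ≡ 2 + ∣ R⁻ ∣
    ∣R∣≡2+∣R⁻∣ =
      trans (∣[]≔false∣ R stem∈R) (cong suc (∣[]≔false∣ (R [ stem ]≔ false) leaf∈R[stem]≔false))
      where
      leaf∈R[stem]≔false : (R [ stem ]≔ false) leaf ≡ true
      leaf∈R[stem]≔false = trans (updateAt-minimal leaf stem R (≢-sym stem≢leaf)) leaf∈R

    R⁻⊆R : ∀ {w} → R⁻ w ≡ true → R w ≡ true × w ≢ stem × w ≢ leaf
    R⁻⊆R {w} w∈R⁻ with w ≟ stem | w ≟ leaf
    ... | _        | yes refl = contradiction (trans (sym w∈R⁻) (updateAt-updates leaf _)) λ ()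
    ... | yes refl | no  _    = contradiction (trans (sym w∈R⁻) stem∉R⁻) λ ()
      where
      stem∉R⁻ : R⁻ stem ≡ false
      stem∉R⁻ = trans (updateAt-minimal stem leaf _ stem≢leaf) (updateAt-updates stem R)
    ... | no  w≢s  | no  w≢l  = trans (sym (R⁻-agrees w≢s w≢l)) w∈R⁻ , w≢s , w≢l

    leaf≁ : ∀ {w} → R w ≡ true → w ≢ stem → adj G leaf w ≡ false
    leaf≁ {w} w∈R w≢stem = Bool.¬-not (λ leaf~w → w≢stem (only-neighbour w w∈R leaf~w))

    module _ {I : Fin n → Bool} (I⊆R⁻ : I ⊆ R⁻) where

      I⁺ : Fin n → Bool
      I⁺ = I [ leaf ]≔ true

      I⁺-cases : ∀ {a} → I⁺ a ≡ true → a ≡ leaf ⊎ I a ≡ true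
      I⁺-cases {a} a∈I⁺ with a ≟ leaf
      ... | yes a≡leaf = inj₁ a≡leaf
      ... | no  a≢leaf = inj₂ (trans (sym (updateAt-minimal a leaf I a≢leaf)) a∈I⁺)

      I⁺⊆R : I⁺ ⊆ R
      I⁺⊆R a a∈I⁺ with I⁺-cases a∈I⁺
      ... | inj₁ refl = leaf∈R
      ... | inj₂ a∈I  = proj₁ (R⁻⊆R (I⊆R⁻ a a∈I))

      leaf≁I : ∀ {b} → I b ≡ true → adj G leaf b ≡ false
      leaf≁I {b} b∈I with R⁻⊆R (I⊆R⁻ b b∈I)
      ... | b∈R , b≢stem , _ = leaf≁ b∈R b≢stem

      I⁺-independent : IndependentSet I → IndependentSet I⁺
      I⁺-independent independent a b a∈I⁺ b∈I⁺ with I⁺-cases a∈I⁺ | I⁺-cases b∈I⁺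
      ... | inj₁ refl | inj₁ refl = irrefl G leaf
      ... | inj₁ refl | inj₂ b∈I  = leaf≁I b∈I
      ... | inj₂ a∈I  | inj₁ refl = trans (adj-sym G a leaf) (leaf≁I a∈I)
      ... | inj₂ a∈I  | inj₂ b∈I  = independent a b a∈I b∈I

      I⁺-counts : ∀ {W : Fin n → Bool} → 2 * ∣ I ∣ ≡ ∣ W ∣ + ∣ R⁻ ∣ → 2 * ∣ I⁺ ∣ ≡ ∣ W ∣ + ∣ R ∣
      I⁺-counts {W} counts = begin
        2 * ∣ I⁺ ∣                 ≡⟨ cong (2 *_) (∣[]≔true∣ I leaf∉I) ⟩
        2 * suc ∣ I ∣              ≡⟨ ℕₚ.*-suc 2 ∣ I ∣ ⟩
        suc (suc (2 * ∣ I ∣))      ≡⟨ cong (λ m → suc (suc m)) counts ⟩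
        suc (suc (∣ W ∣ + ∣ R⁻ ∣)) ≡⟨ cong suc (ℕₚ.+-suc ∣ W ∣ ∣ R⁻ ∣) ⟨
        suc (∣ W ∣ + suc ∣ R⁻ ∣)   ≡⟨ ℕₚ.+-suc ∣ W ∣ (suc ∣ R⁻ ∣) ⟨
        ∣ W ∣ + (2 + ∣ R⁻ ∣)       ≡⟨ cong (∣ W ∣ +_) ∣R∣≡2+∣R⁻∣ ⟨
        ∣ W ∣ + ∣ R ∣              ∎
        where
        open ≡-Reasoning
        leaf∉I : I leaf ≡ false
        leaf∉I = Bool.¬-not (λ leaf∈I → proj₂ (proj₂ (R⁻⊆R (I⊆R⁻ leaf leaf∈I))) refl)

    -- The row of the leaf forces x stem = 0; clearing x at the leaf then gives
    -- a null vector of the subgraph induced by R⁻; and once x vanishes off the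
    -- leaf, the row of the stem forces x leaf = 0.
    module _ {x : Fin n → ℚ} (x-null : InducedNull R x) where

      open InducedNull x-null

      stem-vanishes : x stem ≡ 0ℚ
      stem-vanishes = trans (sym (A·-single x leaf~stem off-stem)) (rows leaf leaf∈R)
        where
        off-stem : ∀ j → j ≢ stem → A[ G ] leaf j ℚ.* x j ≡ 0ℚ
        off-stem j j≢stem with R j in j∈?R
        ... | true  = A-nonadjacent (x j) (leaf≁ j∈?R j≢stem)
        ... | false = trans (cong (A[ G ] leaf j ℚ.*_) (outside j j∈?R)) (ℚₚ.*-zeroʳ (A[ G ] leaf j))

      cleared-null : InducedNull R⁻ (x [ leaf ]≔ 0ℚ)
      cleared-null = record { outside = outside⁻ ; rows = rows⁻ }
        where
        outside⁻ : ∀ j → R⁻ j ≡ false → (x [ leaf ]≔ 0ℚ) j ≡ 0ℚ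
        outside⁻ j j∉R⁻ with j ≟ leaf | j ≟ stem
        ... | yes refl | _        = updateAt-updates leaf x
        ... | no  j≢l  | yes refl = trans (updateAt-minimal stem leaf x j≢l) stem-vanishes
        ... | no  j≢l  | no  j≢s  =
          trans (updateAt-minimal j leaf x j≢l) (outside j (trans (sym (R⁻-agrees j≢s j≢l)) j∉R⁻))

        rows⁻ : ∀ w → R⁻ w ≡ true → (A[ G ]· (x [ leaf ]≔ 0ℚ)) w ≡ 0ℚ
        rows⁻ w w∈R⁻ with R⁻⊆R w∈R⁻
        ... | w∈R , w≢stem , _ =
          trans (A·-[]≔ x 0ℚ (trans (adj-sym G w leaf) (leaf≁ w∈R w≢stem))) (rows w w∈R)

      leaf-vanishes : (∀ j → j ≢ leaf → x j ≡ 0ℚ) → x leaf ≡ 0ℚ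
      leaf-vanishes off-leaf = trans (sym (A·-single x (Adj-sym G leaf~stem) off-leaf′)) (rows stem stem∈R)
        where
        off-leaf′ : ∀ j → j ≢ leaf → A[ G ] stem j ℚ.* x j ≡ 0ℚ
        off-leaf′ j j≢leaf = trans (cong (A[ G ] stem j ℚ.*_) (off-leaf j j≢leaf)) (ℚₚ.*-zeroʳ (A[ G ] stem j))

    off-leaf-vanishes : ∀ {W x} → Determines W R⁻ → InducedNull R x →
                        (∀ w → W w ≡ true → x w ≡ 0ℚ) → ∀ j → j ≢ leaf → x j ≡ 0ℚ
    off-leaf-vanishes {W} {x} determines x-null on-W j j≢leaf =
      trans (sym (updateAt-minimal j leaf x j≢leaf)) (determines _ (cleared-null x-null) cleared-on-W j)
      where
      cleared-on-W : ∀ w → W w ≡ true → (x [ leaf ]≔ 0ℚ) w ≡ 0ℚ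
      cleared-on-W w w∈W with w ≟ leaf
      ... | yes refl   = updateAt-updates leaf x
      ... | no  w≢leaf = trans (updateAt-minimal w leaf x w≢leaf) (on-W w w∈W)

    determines-extend : ∀ {W} → Determines W R⁻ → Determines W R
    determines-extend determines x x-null on-W v with v ≟ leaf
    ... | yes refl   = leaf-vanishes x-null (off-leaf-vanishes determines x-null on-W)
    ... | no  v≢leaf = off-leaf-vanishes determines x-null on-W v v≢leaf

    extend : NullityCertificate R⁻ → NullityCertificate R
    extend C = record
      { W = W ; I = I⁺ I⊆R ; I⊆R = I⁺⊆R I⊆R ; independent = I⁺-independent I⊆R independent
      ; counts = I⁺-counts I⊆R counts ; determines = determines-extend determines
      }
      where open NullityCertificate C

  edge? : ∀ (R : Fin n → Bool) → Dec (∃ λ a → ∃ λ b → R a ≡ true × R b ≡ true × Adj G a b)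
  edge? R = any? λ a → any? λ b → (R a Bool.≟ true) ×-dec (R b Bool.≟ true) ×-dec (adj G a b Bool.≟ true)

  nullity-certificate : Acyclic G → ∀ fuel R → ∣ R ∣ ≤ fuel → NullityCertificate R
  nullity-certificate acyclic fuel R ∣R∣≤fuel with edge? R
  ... | no no-edge = independent-certificate R λ a b a∈R b∈R →
    Bool.¬-not (λ a~b → no-edge (a , b , a∈R , b∈R , a~b))
  ... | yes (a , b , a∈R , b∈R , a~b) = peel fuel ∣R∣≤fuel
    where
    open Peel (pendant-edge G acyclic R a∈R b∈R a~b)
    peel : ∀ fuel → ∣ R ∣ ≤ fuel → NullityCertificate R
    peel zero       ∣R∣≤0      = contradiction (subst (_≤ 0) ∣R∣≡2+∣R⁻∣ ∣R∣≤0) λ ()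
    peel (suc fuel) ∣R∣≤1+fuel = extend (nullity-certificate acyclic fuel R⁻
      (ℕₚ.<⇒≤ (ℕₚ.≤-pred (subst (_≤ suc fuel) ∣R∣≡2+∣R⁻∣ ∣R∣≤1+fuel))))

-- The nullity bound

∈-vertices : ∀ {n} (v : Fin n) → v ∈ vertices n
∈-vertices zero    = here refl
∈-vertices (suc v) = there (∈-map⁺ suc (∈-vertices v))

count≡sum : ∀ {A : Set} (p : A → Bool) xs → count p xs ≡ sum (map (⟦_⟧ ∘ p) xs)
count≡sum p []       = refl
count≡sum p (x ∷ xs) = cong (⟦ p x ⟧ +_) (count≡sum p xs)

sum-map-vertices : ∀ {n} (f : Fin n → ℕ) → sum (map f (vertices n)) ≡ ℕΣ.sum f
sum-map-vertices {zero}  f = refl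
sum-map-vertices {suc n} f =
  cong (f zero +_) (trans (cong sum (sym (map-∘ (vertices n)))) (sum-map-vertices (f ∘ suc)))

count-vertices : ∀ {n} (p : Fin n → Bool) → count p (vertices n) ≡ ∣ p ∣
count-vertices {n} p = trans (count≡sum p (vertices n)) (sum-map-vertices (⟦_⟧ ∘ p))

length-filterᵇ : ∀ {A : Set} (p : A → Bool) xs → length (filterᵇ p xs) ≡ count p xs
length-filterᵇ p []       = refl
length-filterᵇ p (x ∷ xs) with p x
... | true  = cong suc (length-filterᵇ p xs)
... | false = length-filterᵇ p xs

module _ {n} (G : Graph n) where

  A·-lincomb : ∀ {k} c (xs : Fin k → Fin n → ℚ) w →
               (A[ G ]· lincomb c xs) w ≡ lincomb c (λ l → A[ G ]· xs l) w
  A·-lincomb c xs w = begin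
    ℚΣ.sum (λ v → A[ G ] w v ℚ.* ℚΣ.sum (λ l → c l ℚ.* xs l v))
      ≡⟨ ℚΣ.sum-cong-≗ (λ v → ℚΣ.*-distribˡ-sum (A[ G ] w v) (λ l → c l ℚ.* xs l v)) ⟩
    ℚΣ.sum (λ v → ℚΣ.sum (λ l → A[ G ] w v ℚ.* (c l ℚ.* xs l v)))
      ≡⟨ ℚΣ.∑-comm (λ v l → A[ G ] w v ℚ.* (c l ℚ.* xs l v)) ⟩
    ℚΣ.sum (λ l → ℚΣ.sum (λ v → A[ G ] w v ℚ.* (c l ℚ.* xs l v)))
      ≡⟨ ℚΣ.sum-cong-≗ (λ l → ℚΣ.sum-cong-≗ (λ v →
           solve 3 (λ a c x → a :* (c :* x) := c :* (a :* x)) refl (A[ G ] w v) (c l) (xs l v))) ⟩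
    ℚΣ.sum (λ l → ℚΣ.sum (λ v → c l ℚ.* (A[ G ] w v ℚ.* xs l v)))
      ≡⟨ ℚΣ.sum-cong-≗ (λ l → ℚΣ.*-distribˡ-sum (c l) (λ v → A[ G ] w v ℚ.* xs l v)) ⟨
    lincomb c (λ l → A[ G ]· xs l) w ∎
    where
    open ≡-Reasoning
    open ℚ-Solver.+-*-Solver using (solve; _:*_; _:=_)

  independent-null-family≤∣W∣ : ∀ {W k} → Determines G W (const true) → (xs : Fin k → Fin n → ℚ) →
                                (∀ l → InKernel G (xs l)) → LinearlyIndependent xs → k ≤ ∣ W ∣
  independent-null-family≤∣W∣ {W} {k} determines xs null independent =
    subst (k ≤_) (trans (length-filterᵇ W (vertices n)) (count-vertices W))
          (independent⇒≤dim (length members) restricted restricted-independent)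
    where
    members = filterᵇ W (vertices n)

    restricted : Fin k → Fin (length members) → ℚ
    restricted l j = xs l (lookup members j)

    restricted-independent : Independent restricted
    restricted-independent c vanishes = LinearlyIndependent⇒Independent independent c combination-vanishes
      where
      combination-null : InducedNull G (const true) (lincomb c xs)
      combination-null = record
        { outside = λ _ ()
        ; rows    = λ w _ → trans (A·-lincomb c xs w) (lincomb-vanishing c (λ l → A[ G ]· xs l) w
                      (λ l → trans (sym (Σ[]≡sum (λ v → A[ G ] w v ℚ.* xs l v))) (null l w)))
        }

      on-W : ∀ w → W w ≡ true → lincomb c xs w ≡ 0ℚ
      on-W w w∈W = trans (cong (lincomb c xs) (lookup-index w∈members)) (vanishes (Any.index w∈members))
        where
        w∈members : w ∈ members
        w∈members = ∈-filter⁺ (Data.Bool.T? ∘ W) (∈-vertices w) (subst Data.Bool.T (sym w∈W) _)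

      combination-vanishes : ∀ u → lincomb c xs u ≡ 0ℚ
      combination-vanishes = determines (lincomb c xs) combination-null on-W

-- Independent sets and the annihilation number

sum-map-filterᵇ : ∀ {A : Set} (p : A → Bool) (f : A → ℕ) xs →
                  sum (map f (filterᵇ p xs)) ≡ sum (map (λ x → if p x then f x else 0) xs)
sum-map-filterᵇ p f []       = refl
sum-map-filterᵇ p f (x ∷ xs) with p x
... | true  = cong (f x +_) (sum-map-filterᵇ p f xs)
... | false = sum-map-filterᵇ p f xs

filterᵇ-partition : ∀ {A : Set} (p : A → Bool) xs → filterᵇ p xs ++ filterᵇ (not ∘ p) xs ↭ xs
filterᵇ-partition p []       = ↭-refl
filterᵇ-partition p (x ∷ xs) with p x
... | true  = prep x (filterᵇ-partition p xs)
... | false = ↭-trans (shift x (filterᵇ p xs) _) (prep x (filterᵇ-partition p xs))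

∈⇒↭-∷ : ∀ {A : Set} {x : A} {xs} → x ∈ xs → ∃ λ xs′ → xs ↭ x ∷ xs′
∈⇒↭-∷ x∈xs with ∈-∃++ x∈xs
... | as , bs , refl = as ++ bs , shift _ as bs

head-minimal : ∀ {x y : ℕ} {xs} → Linked _≤_ (x ∷ xs) → y ∈ xs → x ≤ y
head-minimal (x≤ ∷ _)      (here refl) = x≤
head-minimal (x≤ ∷ sorted) (there y∈)  = ℕₚ.≤-trans x≤ (head-minimal sorted y∈)

-- The minimum x of xs is either an element of ys, or at most the first
-- element of ys; either way it pays for one summand of sum ys.
sum-take-sorted : ∀ {xs} → Linked _≤_ xs → ∀ ys {zs} → ys ++ zs ↭ xs → sum (take (length ys) xs) ≤ sum ys
sum-take-sorted {[]}     _      []      _ = z≤n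
sum-take-sorted {[]}     _      (_ ∷ _) _ = z≤n
sum-take-sorted {x ∷ xs} sorted ys {zs} ys++zs↭ =
  [ taken ∘ ∈⇒↭-∷ , skipped ∘ ∈⇒↭-∷ ]′ (∈-++⁻ ys (∈-resp-↭ (↭-sym ys++zs↭) (here refl)))
  where
  taken : (∃ λ ys′ → ys ↭ x ∷ ys′) → sum (take (length ys) (x ∷ xs)) ≤ sum ys
  taken (ys′ , ys↭) =
    subst₂ _≤_ (cong (λ k → sum (take k (x ∷ xs))) (sym (↭-length ys↭))) (sym (sum-↭ ys↭))
      (ℕₚ.+-monoʳ-≤ x (sum-take-sorted (Linked.tail sorted) ys′ ys′++zs↭))
    where
    ys′++zs↭ : ys′ ++ zs ↭ xs
    ys′++zs↭ = drop-∷ (↭-trans (↭-sym (++⁺ʳ zs ys↭)) ys++zs↭)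

  skipped : (∃ λ zs′ → zs ↭ x ∷ zs′) → sum (take (length ys) (x ∷ xs)) ≤ sum ys
  skipped (zs′ , zs↭) = bound ys ys++zs′↭
    where
    ys++zs′↭ : ys ++ zs′ ↭ xs
    ys++zs′↭ = drop-∷ (↭-trans (↭-sym (↭-trans (++⁺ˡ ys zs↭) (shift x ys zs′))) ys++zs↭)

    bound : ∀ ys → ys ++ zs′ ↭ xs → sum (take (length ys) (x ∷ xs)) ≤ sum ys
    bound []       _          = z≤n
    bound (y ∷ ys) y∷ys++zs′↭ = ℕₚ.+-mono-≤ (head-minimal sorted (∈-resp-↭ y∷ys++zs′↭ (here refl)))
      (sum-take-sorted (Linked.tail sorted) ys (↭-trans (shift y ys zs′) y∷ys++zs′↭))

sum-mono-≤ : ∀ {n} {f g : Fin n → ℕ} → (∀ i → f i ≤ g i) → ℕΣ.sum f ≤ ℕΣ.sum g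
sum-mono-≤ {zero}  _   = z≤n
sum-mono-≤ {suc n} f≤g = ℕₚ.+-mono-≤ (f≤g zero) (sum-mono-≤ (f≤g ∘ suc))

∑∑-symmetrise : ∀ {n} (f : Fin n → Fin n → ℕ) →
                ℕΣ.sum (λ u → ℕΣ.sum (λ v → f u v + f v u)) ≡ 2 * ℕΣ.sum (λ u → ℕΣ.sum (f u))
∑∑-symmetrise f = begin
  ℕΣ.sum (λ u → ℕΣ.sum (λ v → f u v + f v u))
    ≡⟨ ℕΣ.sum-cong-≗ (λ u → ℕΣ.∑-distrib-+ (f u) (λ v → f v u)) ⟩
  ℕΣ.sum (λ u → ℕΣ.sum (f u) + ℕΣ.sum (λ v → f v u))
    ≡⟨ ℕΣ.∑-distrib-+ (λ u → ℕΣ.sum (f u)) (λ u → ℕΣ.sum (λ v → f v u)) ⟩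
  S + ℕΣ.sum (λ u → ℕΣ.sum (λ v → f v u))
    ≡⟨ cong (S +_) (ℕΣ.∑-comm (λ u v → f v u)) ⟩
  S + S
    ≡⟨ cong (S +_) (ℕₚ.+-identityʳ S) ⟨
  2 * S ∎
  where
  open ≡-Reasoning
  S = ℕΣ.sum (λ u → ℕΣ.sum (f u))

at-most-one-endpoint : ∀ a b c → (a ≡ true → b ≡ true → c ≡ false) → ⟦ a ∧ c ⟧ + ⟦ b ∧ c ⟧ ≤ ⟦ c ⟧
at-most-one-endpoint true  true  c excl = subst (λ c → ⟦ c ⟧ + ⟦ c ⟧ ≤ ⟦ c ⟧) (sym (excl refl refl)) z≤n
at-most-one-endpoint true  false c _    = ℕₚ.≤-reflexive (ℕₚ.+-identityʳ ⟦ c ⟧)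
at-most-one-endpoint false true  c _    = ℕₚ.≤-refl
at-most-one-endpoint false false c _    = z≤n

module _ {n} (G : Graph n) where

  ascending : Fin n → Fin n → Bool
  ascending u v = if toℕ u <ᵇ toℕ v then adj G u v else false

  size≡∑∑ : size G ≡ ℕΣ.sum (λ u → ℕΣ.sum (λ v → ⟦ ascending u v ⟧))
  size≡∑∑ = trans (sum-map-vertices (edgesFrom G)) (ℕΣ.sum-cong-≗ (λ u → count-vertices (ascending u)))

  ascending-edge : ∀ {u v} → Adj G u v → toℕ u < toℕ v → ascending u v ≡ true
  ascending-edge u~v u<v rewrite Equivalence.to Bool.T-≡ (ℕₚ.<⇒<ᵇ u<v) = u~v

  edge-counted : ∀ u v → ⟦ adj G u v ⟧ ≤ ⟦ ascending u v ⟧ + ⟦ ascending v u ⟧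
  edge-counted u v with adj G u v Bool.≟ true
  ... | no  u≁v = subst (λ b → ⟦ b ⟧ ≤ ⟦ ascending u v ⟧ + ⟦ ascending v u ⟧) (sym (Bool.¬-not u≁v)) z≤n
  ... | yes u~v with ℕₚ.<-cmp (toℕ u) (toℕ v)
  ...   | tri< u<v _ _ = subst₂ (λ b c → ⟦ b ⟧ ≤ ⟦ c ⟧ + ⟦ ascending v u ⟧)
                           (sym u~v) (sym (ascending-edge u~v u<v)) (s≤s z≤n)
  ...   | tri≈ _ u≡v _ = contradiction (toℕ-injective u≡v) (Adj⇒≢ G u~v)
  ...   | tri> _ _ v<u = subst₂ (λ b c → ⟦ b ⟧ ≤ ⟦ ascending u v ⟧ + ⟦ c ⟧)
                           (sym u~v) (sym (ascending-edge (Adj-sym G u~v) v<u)) (ℕₚ.m≤n+m 1 ⟦ ascending u v ⟧)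

  endpoints-in-independent : ∀ {I} → IndependentSet G I → ∀ u v →
                             ⟦ I u ∧ adj G u v ⟧ + ⟦ I v ∧ adj G v u ⟧ ≤ ⟦ adj G u v ⟧
  endpoints-in-independent {I} independent u v rewrite adj-sym G v u =
    at-most-one-endpoint (I u) (I v) (adj G u v) (independent u v)

  degree-sum≡∑∑ : ∀ I → sum (map (degree G) (filterᵇ I (vertices n))) ≡
                        ℕΣ.sum (λ u → ℕΣ.sum (λ v → ⟦ I u ∧ adj G u v ⟧))
  degree-sum≡∑∑ I = begin
    sum (map (degree G) (filterᵇ I (vertices n)))
      ≡⟨ sum-map-filterᵇ I (degree G) (vertices n) ⟩
    sum (map (λ u → if I u then degree G u else 0) (vertices n))
      ≡⟨ sum-map-vertices (λ u → if I u then degree G u else 0) ⟩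
    ℕΣ.sum (λ u → if I u then degree G u else 0)
      ≡⟨ ℕΣ.sum-cong-≗ row ⟩
    ℕΣ.sum (λ u → ℕΣ.sum (λ v → ⟦ I u ∧ adj G u v ⟧)) ∎
    where
    open ≡-Reasoning
    row : ∀ u → (if I u then degree G u else 0) ≡ ℕΣ.sum (λ v → ⟦ I u ∧ adj G u v ⟧)
    row u with I u
    ... | true  = count-vertices (adj G u)
    ... | false = sym (ℕΣ.sum-replicate-zero n)

  -- Symmetrised, both sides compare pointwise: an edge has at most one
  -- endpoint in I, and size counts it in exactly one orientation.
  independent-degree-sum≤size : ∀ {I} → IndependentSet G I →
                                sum (map (degree G) (filterᵇ I (vertices n))) ≤ size G
  independent-degree-sum≤size {I} independent =
    subst₂ _≤_ (sym (degree-sum≡∑∑ I)) (sym size≡∑∑) (ℕₚ.*-cancelˡ-≤ 2 (begin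
      2 * ℕΣ.sum (λ u → ℕΣ.sum (λ v → ⟦ I u ∧ adj G u v ⟧))
        ≡⟨ ∑∑-symmetrise (λ u v → ⟦ I u ∧ adj G u v ⟧) ⟨
      ℕΣ.sum (λ u → ℕΣ.sum (λ v → ⟦ I u ∧ adj G u v ⟧ + ⟦ I v ∧ adj G v u ⟧))
        ≤⟨ sum-mono-≤ (λ u → sum-mono-≤ (λ v →
             ℕₚ.≤-trans (endpoints-in-independent independent u v) (edge-counted u v))) ⟩
      ℕΣ.sum (λ u → ℕΣ.sum (λ v → ⟦ ascending u v ⟧ + ⟦ ascending v u ⟧))
        ≡⟨ ∑∑-symmetrise (λ u v → ⟦ ascending u v ⟧) ⟩
      2 * ℕΣ.sum (λ u → ℕΣ.sum (λ v → ⟦ ascending u v ⟧)) ∎))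
    where open ℕₚ.≤-Reasoning

  independent≤annihilation : ∀ {a I} → IsAnnihilationNumber G a → IndependentSet G I → ∣ I ∣ ≤ a
  independent≤annihilation {a} {I} (_ , _ , maximal) independent = maximal ∣ I ∣ (∣∣≤n I) (begin
    sum (take ∣ I ∣ (sortedDegrees G))
      ≡⟨ cong (λ k → sum (take k (sortedDegrees G))) length-degrees ⟨
    sum (take (length degrees) (sortedDegrees G))
      ≤⟨ sum-take-sorted (sort-↗ (map (degree G) (vertices n))) degrees partition ⟩
    sum degrees
      ≤⟨ independent-degree-sum≤size independent ⟩
    size G ∎)
    where
    open ℕₚ.≤-Reasoning
    degrees = map (degree G) (filterᵇ I (vertices n))

    length-degrees : length degrees ≡ ∣ I ∣
    length-degrees = trans (length-map (degree G) (filterᵇ I (vertices n)))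
                           (trans (length-filterᵇ I (vertices n)) (count-vertices I))

    partition : degrees ++ map (degree G) (filterᵇ (not ∘ I) (vertices n)) ↭ sortedDegrees G
    partition = ↭-trans (subst (_↭ map (degree G) (vertices n)) (map-++ (degree G) (filterᵇ I (vertices n)) _)
                                 (map⁺ (degree G) (filterᵇ-partition I (vertices n))))
                        (↭-sym (sort-↭ (map (degree G) (vertices n))))

theorem5 : ∀ (n : ℕ) (T : Graph n) → IsTree T → ∀ (η a : ℕ) → IsNullity T η → IsAnnihilationNumber T a → η + n ≤ 2 * a
theorem5 n T (_ , _ , acyclic) η a ((basis , basis-null , basis-independent) , _) annihilation = begin
  η + n                              ≤⟨ ℕₚ.+-monoˡ-≤ n η≤∣W∣ ⟩
  ∣ W ∣ + n                          ≡⟨ cong (∣ W ∣ +_) (∣full∣≡n n) ⟨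
  ∣ W ∣ + ∣ const {B = Fin n} true ∣ ≡⟨ counts ⟨
  2 * ∣ I ∣                          ≤⟨ ℕₚ.*-monoʳ-≤ 2 ∣I∣≤a ⟩
  2 * a                              ∎
  where
  open ℕₚ.≤-Reasoning
  open NullityCertificate (nullity-certificate T acyclic n (const true) (ℕₚ.≤-reflexive (∣full∣≡n n)))

  η≤∣W∣ : η ≤ ∣ W ∣
  η≤∣W∣ = independent-null-family≤∣W∣ T determines basis basis-null basis-independent

  ∣I∣≤a : ∣ I ∣ ≤ a
  ∣I∣≤a = independent≤annihilation T annihilation independent
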